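{- Let $q=2$ and let $d,e$ be positive integers with $e\geq d+1$. For $0\leq i,j\leq d$ let $$B_j(i)=\sum_{h=0}^{j}(-1)^{j-h}2^{eh+\binom{j-h}{2}}{d-h \brack d-j}_2{d-i \brack h}_2.$$ Then for all $0\leq i\leq d-1$ and $1\leq j\leq d$, $|B_j(i)|>|B_j(i+1)|$.
   Context: For integers $N\geq 0$ and $k$, ${N \brack k}_2=\prod_{t=1}^{k}\frac{2^{N-k+t}-1}{2^t-1}$ if $0\leq k\leq N$, and $0$ if $k<0$ or $k>N$. The $B_j(i)$ are the eigenvalues of the bilinear forms graph $H_2(d,e,j)$. -}

module Defs where

open import Data.Nat as ℕ using (ℕ; zero; suc; _∸_; _^_; _≤_; _<_; NonZero)
open import Data.Nat.DivMod using (_/_)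
open import Data.Nat.Combinatorics using (_C_)
open import Data.Integer as ℤ using (ℤ; +_; -_; ∣_∣)

prodFrom1 : ℕ → (ℕ → ℕ) → ℕ
prodFrom1 zero    f = 1
prodFrom1 (suc k) f = prodFrom1 k f ℕ.* f (suc k)

sumTo : ℕ → (ℕ → ℤ) → ℤ
sumTo zero    g = g 0
sumTo (suc j) g = sumTo j g ℤ.+ g (suc j)

den : ℕ → ℕ
den k = prodFrom1 k (λ t → 2 ^ t ∸ 1)

private
  pow-pos : ∀ t → 1 ℕ.≤ 2 ^ t
  pow-pos zero = ℕ.s≤s ℕ.z≤n
  pow-pos (suc t) = Data.Nat.Properties.≤-trans (pow-pos t) (Data.Nat.Properties.m≤m+n (2 ^ t) _)
    where import Data.Nat.Properties

  open import Data.Nat.Properties using (m*n≢0; m>n⇒m∸n≢0)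
  open import Relation.Nullary using (yes; no)

  pow-sub : ∀ t → NonZero (2 ^ suc t ∸ 1)
  pow-sub t = ℕ.≢-nonZero (m>n⇒m∸n≢0 (lem t))
    where
    import Data.Nat.Properties as P
    lem : ∀ t → 1 ℕ.< 2 ^ suc t
    lem t = P.+-mono-≤ (pow-pos t) (P.≤-trans (pow-pos t) (P.m≤m+n (2 ^ t) 0))

  den-nz : ∀ k → NonZero (den k)
  den-nz zero = _
  den-nz (suc k) = m*n≢0 (den k) (2 ^ suc k ∸ 1) {{den-nz k}} {{pow-sub k}}

-- Gaussian binomial coefficient [N k]_2 for 0 ≤ k ≤ N:
-- ∏_{t=1}^{k} (2^{N-k+t} - 1) / ∏_{t=1}^{k} (2^t - 1)   (exact division)
gaussNat : ℕ → ℕ → ℕ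
gaussNat N k = prodFrom1 k (λ t → 2 ^ (N ∸ k ℕ.+ t) ∸ 1) / den k
  where instance _ = den-nz k

gauss : ℕ → ℤ → ℤ
gauss N (ℤ.negsuc _) = + 0
gauss N (+ k) with k ℕ.≤? N
... | yes _ = + gaussNat N k
... | no  _ = + 0
  where open import Relation.Nullary using (yes; no)

sign : ℕ → ℤ
sign zero    = + 1
sign (suc n) = - sign n

B : (d e j i : ℕ) → ℤ
B d e j i = sumTo j (λ h →
  sign (j ∸ h) ℤ.* (+ (2 ^ (e ℕ.* h ℕ.+ ((j ∸ h) C 2))))
    ℤ.* gauss (d ∸ h) (+ d ℤ.- + j)
    ℤ.* gauss (d ∸ i) (+ h))

module Submission where

-- Write B′ for the values at the parameters (d+1, e+1) and T(i) = 2^(e+1+d-i) B_j(i).  The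
-- q-Pascal rule in the factor [d-i, h] gives B′_{j+1}(i) = T(i) + B′_{j+1}(i+1), and
-- B′_{j+1}(d+1) = (-1)^(j+1) 2^C(j+1,2) [d+1, d-j] is explicit.  By induction on d, B_j(i) is
-- nonzero with sign (-1)^max(0, i-(d-j)) and |B_j(i)| strictly decreases in i.  Unrolling the
-- recurrence downwards from i = d+1: for i < d-j both summands are positive, so absolute values
-- add up; from d-j on the signs alternate and 2|B′_{j+1}(i+1)| < |T(i)| (the weight halves while
-- |B_j| decreases, and at i = d a direct comparison, which is where e ≥ d+1 enters), hence
-- |B′_{j+1}(i)| = |T(i)| - |B′_{j+1}(i+1)| > |B′_{j+1}(i+1)|.

open import Defs

module QBinomial where

  open import Data.Nat
  open import Data.Nat.Properties
  open import Data.Nat.DivMod using (_/_; m*n/n≡m)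
  open import Data.Nat.Solver using (module +-*-Solver)
  open import Data.Integer using (+_)
  open import Relation.Binary.PropositionalEquality
  open import Relation.Nullary using (yes; no)
  open +-*-Solver

  qbin : ℕ → ℕ → ℕ
  qbin zero    zero    = 1
  qbin zero    (suc k) = 0
  qbin (suc n) zero    = 1
  qbin (suc n) (suc k) = 2 ^ (n ∸ k) * qbin n k + qbin n (suc k)

  qbin-zeroʳ : ∀ n → qbin n 0 ≡ 1
  qbin-zeroʳ zero    = refl
  qbin-zeroʳ (suc n) = refl

  qbin-> : ∀ {n k} → n < k → qbin n k ≡ 0
  qbin-> {zero}  {suc k} _ = refl
  qbin-> {suc n} {suc k} (s≤s n<k)
    rewrite qbin-> n<k | qbin-> (m<n⇒m<1+n n<k) | *-zeroʳ (2 ^ (n ∸ k)) = refl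

  qbin-diag : ∀ n → qbin n n ≡ 1
  qbin-diag zero    = refl
  qbin-diag (suc n) rewrite n∸n≡0 n | qbin-diag n | qbin-> (n<1+n n) = refl

  qbin-pos : ∀ {n k} → k ≤ n → 0 < qbin n k
  qbin-pos {n}     {zero}  _         = subst (0 <_) (sym (qbin-zeroʳ n)) z<s
  qbin-pos {suc n} {suc k} (s≤s k≤n) =
    ≤-trans (*-mono-≤ (m^n>0 2 (n ∸ k)) (qbin-pos k≤n)) (m≤m+n _ (qbin n (suc k)))

  qbin-weight : ∀ n k → 2 ^ k * (2 ^ (n ∸ k) * qbin n k) ≡ 2 ^ n * qbin n k
  qbin-weight n k with k ≤? n
  ... | yes k≤n = begin
    2 ^ k * (2 ^ (n ∸ k) * qbin n k) ≡⟨ sym (*-assoc (2 ^ k) _ _) ⟩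
    2 ^ k * 2 ^ (n ∸ k) * qbin n k   ≡⟨ cong (_* qbin n k) (sym (^-distribˡ-+-* 2 k (n ∸ k))) ⟩
    2 ^ (k + (n ∸ k)) * qbin n k     ≡⟨ cong (λ m → 2 ^ m * qbin n k) (m+[n∸m]≡n k≤n) ⟩
    2 ^ n * qbin n k                 ∎
    where open ≡-Reasoning
  ... | no  k≰n rewrite qbin-> (≰⇒> k≰n) | *-zeroʳ (2 ^ (n ∸ k)) | *-zeroʳ (2 ^ k) = sym (*-zeroʳ (2 ^ n))

  qbin-+-suc : ∀ m k →
    qbin (suc m + suc k) (suc k) ≡ 2 ^ suc m * qbin (suc m + k) k + qbin (m + suc k) (suc k)
  qbin-+-suc m k rewrite +-suc m k | m+n∸n≡m (suc m) k = refl

  mersenneProd : ℕ → ℕ → ℕ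
  mersenneProd m k = prodFrom1 k (λ t → 2 ^ (m + t) ∸ 1)

  mersenneProd-suc : ∀ m k →
    mersenneProd m (suc k) ≡ (2 ^ suc m ∸ 1) * mersenneProd (suc m) k
  mersenneProd-suc m zero    rewrite +-comm m 1 = trans (*-identityˡ _) (sym (*-identityʳ _))
  mersenneProd-suc m (suc k) = begin
    mersenneProd m (suc k) * (2 ^ (m + suc (suc k)) ∸ 1)
      ≡⟨ cong₂ (λ p n → p * (2 ^ n ∸ 1)) (mersenneProd-suc m k) (+-suc m (suc k)) ⟩
    (2 ^ suc m ∸ 1) * mersenneProd (suc m) k * (2 ^ (suc m + suc k) ∸ 1)
      ≡⟨ *-assoc (2 ^ suc m ∸ 1) _ _ ⟩
    (2 ^ suc m ∸ 1) * mersenneProd (suc m) (suc k) ∎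
    where open ≡-Reasoning

  m*[n∸1]+[m∸1]≡m*n∸1 : ∀ {m n} → 1 ≤ m → 1 ≤ n → m * (n ∸ 1) + (m ∸ 1) ≡ m * n ∸ 1
  m*[n∸1]+[m∸1]≡m*n∸1 {suc m} {suc n} _ _ =
    solve 2 (λ m n → (con 1 :+ m) :* n :+ m := n :+ m :* (con 1 :+ n)) refl m n

  -- The q-analogue of C(m+k, k) · k! = (m+1)(m+2)⋯(m+k).
  qbin-*-den : ∀ m k → qbin (m + k) k * den k ≡ mersenneProd m k
  qbin-*-den m       zero    = cong (_* 1) (qbin-zeroʳ (m + 0))
  qbin-*-den zero    (suc k) rewrite qbin-diag (suc k) = *-identityˡ _
  qbin-*-den (suc m) (suc k) = begin
    qbin (suc m + suc k) (suc k) * (den k * (Y ∸ 1))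
      ≡⟨ cong (_* (den k * (Y ∸ 1))) (qbin-+-suc m k) ⟩
    (X * qbin (suc m + k) k + qbin (m + suc k) (suc k)) * (den k * (Y ∸ 1))
      ≡⟨ *-distribʳ-+ _ (X * qbin (suc m + k) k) _ ⟩
    X * qbin (suc m + k) k * (den k * (Y ∸ 1)) + qbin (m + suc k) (suc k) * den (suc k)
      ≡⟨ cong₂ _+_ (regroup X (qbin (suc m + k) k) (den k) (Y ∸ 1)) (qbin-*-den m (suc k)) ⟩
    X * (Y ∸ 1) * (qbin (suc m + k) k * den k) + mersenneProd m (suc k)
      ≡⟨ cong₂ (λ p q → X * (Y ∸ 1) * p + q) (qbin-*-den (suc m) k) (mersenneProd-suc m k) ⟩
    X * (Y ∸ 1) * P + (X ∸ 1) * P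
      ≡⟨ sym (*-distribʳ-+ P (X * (Y ∸ 1)) _) ⟩
    (X * (Y ∸ 1) + (X ∸ 1)) * P
      ≡⟨ cong (_* P) (m*[n∸1]+[m∸1]≡m*n∸1 (m^n>0 2 (suc m)) (m^n>0 2 (suc k))) ⟩
    (X * Y ∸ 1) * P
      ≡⟨ cong (λ n → (n ∸ 1) * P) (sym (^-distribˡ-+-* 2 (suc m) (suc k))) ⟩
    (2 ^ (suc m + suc k) ∸ 1) * P
      ≡⟨ *-comm _ P ⟩
    mersenneProd (suc m) (suc k) ∎
    where
    open ≡-Reasoning
    X = 2 ^ suc m
    Y = 2 ^ suc k
    P = mersenneProd (suc m) k
    regroup : ∀ x q d y → x * q * (d * y) ≡ x * y * (q * d)
    regroup = solve 4 (λ x q d y → x :* q :* (d :* y) := x :* y :* (q :* d)) refl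

  den-pos : ∀ k → 0 < den k
  den-pos zero    = z<s
  den-pos (suc k) = *-mono-≤ (den-pos k) (m<n⇒0<n∸m (*-monoʳ-≤ 2 (m^n>0 2 k)))

  den-nonZero : ∀ k → NonZero (den k)
  den-nonZero k = >-nonZero (den-pos k)

  gauss≡qbin : ∀ N k → gauss N (+ k) ≡ + qbin N k
  gauss≡qbin N k with k ≤? N
  ... | no  k≰N = cong +_ (sym (qbin-> (≰⇒> k≰N)))
  ... | yes k≤N = cong +_ (begin
    gaussNat N k
      ≡⟨ cong (_/ den k) (sym (qbin-*-den (N ∸ k) k)) ⟩
    qbin (N ∸ k + k) k * den k / den k
      ≡⟨ m*n/n≡m _ (den k) ⟩
    qbin (N ∸ k + k) k
      ≡⟨ cong (λ n → qbin n k) (m∸n+n≡m k≤N) ⟩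
    qbin N k ∎)
    where
    open ≡-Reasoning
    instance _ = den-nonZero k

  qbin-ratio : ∀ j s → (2 ^ suc j ∸ 1) * qbin (suc j + s) s ≡ (2 ^ (suc j + s) ∸ 1) * qbin (j + s) s
  qbin-ratio j s = *-cancelʳ-≡ _ _ (den s) (begin
    (2 ^ suc j ∸ 1) * qbin (suc j + s) s * den s       ≡⟨ *-assoc (2 ^ suc j ∸ 1) _ _ ⟩
    (2 ^ suc j ∸ 1) * (qbin (suc j + s) s * den s)     ≡⟨ cong ((2 ^ suc j ∸ 1) *_) (qbin-*-den (suc j) s) ⟩
    (2 ^ suc j ∸ 1) * mersenneProd (suc j) s           ≡⟨ sym (mersenneProd-suc j s) ⟩
    mersenneProd j s * (2 ^ (j + suc s) ∸ 1)           ≡⟨ cong (λ m → mersenneProd j s * (2 ^ m ∸ 1)) (+-suc j s) ⟩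
    mersenneProd j s * (2 ^ (suc j + s) ∸ 1)           ≡⟨ *-comm (mersenneProd j s) _ ⟩
    (2 ^ (suc j + s) ∸ 1) * mersenneProd j s           ≡⟨ cong ((2 ^ (suc j + s) ∸ 1) *_) (sym (qbin-*-den j s)) ⟩
    (2 ^ (suc j + s) ∸ 1) * (qbin (j + s) s * den s)   ≡⟨ sym (*-assoc (2 ^ (suc j + s) ∸ 1) _ _) ⟩
    (2 ^ (suc j + s) ∸ 1) * qbin (j + s) s * den s     ∎)
    where
    open ≡-Reasoning
    instance _ = den-nonZero s

  n≤2*n∸1 : ∀ {n} → 1 ≤ n → n ≤ 2 * n ∸ 1
  n≤2*n∸1 {suc n} _ rewrite +-suc n (n + 0) = s≤s (m≤m+n n (n + 0))

  -- Multiply by 2^(j+1) - 1 and use qbin-ratio; what remains is 2^j (2^(j+s+1) - 1) < 2^(j+s+1) (2^(j+1) - 1).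
  2^j*qbin-suc< : ∀ j s {e} → suc (j + s) ≤ e → 2 ^ j * qbin (suc j + s) s < 2 ^ e * qbin (j + s) s
  2^j*qbin-suc< j s {e} j+s<e = *-cancelˡ-< A _ _ (begin-strict
    A * (W * qbin (suc j + s) s)       ≡⟨ x*[y*z]≡y*[x*z] A W _ ⟩
    W * (A * qbin (suc j + s) s)       ≡⟨ cong (W *_) (qbin-ratio j s) ⟩
    W * ((M ∸ 1) * q)                  ≡⟨ sym (*-assoc W (M ∸ 1) q) ⟩
    W * (M ∸ 1) * q                    <⟨ *-monoˡ-< q (*-monoʳ-< W (∸-monoʳ-< {n = 1} z<s (m^n>0 2 (suc j + s)))) ⟩
    W * (M ∸ 0) * q                    ≡⟨ cong (_* q) (*-comm W M) ⟩
    M * W * q                          ≤⟨ *-monoˡ-≤ q (*-mono-≤ (^-monoʳ-≤ 2 j+s<e) (n≤2*n∸1 (m^n>0 2 j))) ⟩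
    2 ^ e * A * q                      ≡⟨ x*y*z≡y*[x*z] (2 ^ e) A q ⟩
    A * (2 ^ e * q)                    ∎)
    where
    open ≤-Reasoning
    W = 2 ^ j
    A = 2 ^ suc j ∸ 1
    M = 2 ^ (suc j + s)
    q = qbin (j + s) s
    instance
      _ = >-nonZero (qbin-pos (m≤n+m s j))
      _ = >-nonZero (m^n>0 2 j)
    x*[y*z]≡y*[x*z] : ∀ x y z → x * (y * z) ≡ y * (x * z)
    x*[y*z]≡y*[x*z] = solve 3 (λ x y z → x :* (y :* z) := y :* (x :* z)) refl
    x*y*z≡y*[x*z] : ∀ x y z → x * y * z ≡ y * (x * z)
    x*y*z≡y*[x*z] = solve 3 (λ x y z → x :* y :* z := y :* (x :* z)) refl


module Summands where

  open QBinomial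
  open import Data.Nat
  open import Data.Nat.Properties
  open import Data.Nat.Combinatorics using (_C_; nC1≡n; nCk+nC[k+1]≡[n+1]C[k+1])
  open import Data.Nat.Solver using (module +-*-Solver)
  open import Relation.Binary.PropositionalEquality
  open +-*-Solver

  summand : (d e j i h : ℕ) → ℕ
  summand d e j i h = 2 ^ (e * h + (j ∸ h) C 2) * qbin (d ∸ h) (d ∸ j) * qbin (d ∸ i) h

  summand-pascal : ∀ {d i} e j h → i ≤ d →
    summand (suc d) (suc e) (suc j) i (suc h)
      ≡ 2 ^ (suc e + (d ∸ i)) * summand d e j i h + summand (suc d) (suc e) (suc j) (suc i) (suc h)
  summand-pascal {d} {i} e j h i≤d rewrite +-∸-assoc 1 i≤d = begin
    P * g * (2 ^ (n ∸ h) * x + y)                   ≡⟨ *-distribˡ-+ (P * g) _ y ⟩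
    P * g * (2 ^ (n ∸ h) * x) + P * g * y           ≡⟨ cong (_+ P * g * y) rescale ⟩
    2 ^ (suc e + n) * (P₀ * g * x) + P * g * y      ∎
    where
    open ≡-Reasoning
    n = d ∸ i
    c = (j ∸ h) C 2
    P = 2 ^ (suc e * suc h + c)
    P₀ = 2 ^ (e * h + c)
    g = qbin (d ∸ h) (d ∸ j)
    x = qbin n h
    y = qbin n (suc h)
    P-split : P ≡ 2 ^ suc e * 2 ^ h * P₀
    P-split = begin
      2 ^ (suc e * suc h + c)
        ≡⟨ cong (2 ^_) (solve 3 (λ e h c → (con 1 :+ e) :* (con 1 :+ h) :+ c
                                          := (con 1 :+ e) :+ h :+ (e :* h :+ c)) refl e h c) ⟩
      2 ^ (suc e + h + (e * h + c))     ≡⟨ ^-distribˡ-+-* 2 (suc e + h) _ ⟩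
      2 ^ (suc e + h) * P₀              ≡⟨ cong (_* P₀) (^-distribˡ-+-* 2 (suc e) h) ⟩
      2 ^ suc e * 2 ^ h * P₀            ∎
    rescale : P * g * (2 ^ (n ∸ h) * x) ≡ 2 ^ (suc e + n) * (P₀ * g * x)
    rescale = begin
      P * g * (2 ^ (n ∸ h) * x)
        ≡⟨ cong (λ p → p * g * (2 ^ (n ∸ h) * x)) P-split ⟩
      2 ^ suc e * 2 ^ h * P₀ * g * (2 ^ (n ∸ h) * x)
        ≡⟨ solve 5 (λ a b p g z → a :* b :* p :* g :* z := a :* (p :* g) :* (b :* z)) refl
                   (2 ^ suc e) (2 ^ h) P₀ g (2 ^ (n ∸ h) * x) ⟩
      2 ^ suc e * (P₀ * g) * (2 ^ h * (2 ^ (n ∸ h) * x))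
        ≡⟨ cong (2 ^ suc e * (P₀ * g) *_) (qbin-weight n h) ⟩
      2 ^ suc e * (P₀ * g) * (2 ^ n * x)
        ≡⟨ solve 4 (λ a q b x → a :* q :* (b :* x) := a :* b :* (q :* x)) refl (2 ^ suc e) (P₀ * g) (2 ^ n) x ⟩
      2 ^ suc e * 2 ^ n * (P₀ * g * x)
        ≡⟨ cong (_* (P₀ * g * x)) (sym (^-distribˡ-+-* 2 (suc e) n)) ⟩
      2 ^ (suc e + n) * (P₀ * g * x) ∎

  -- 2|B_{j+1}(d+1)| < 2^(e+1)|B_j(d)| for d = j + s, with both values as given by B-at-top.
  top-corner< : ∀ j s {e} → suc (j + s) ≤ e →
    2 * (2 ^ (suc j C 2) * qbin (suc j + s) s) < 2 ^ suc e * (2 ^ (j C 2) * qbin (j + s) s)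
  top-corner< j s {e} j+s<e = begin-strict
    2 * (2 ^ (suc j C 2) * qbin (suc j + s) s)
      ≡⟨ cong (λ m → 2 * (2 ^ m * qbin (suc j + s) s)) [1+j]C2≡j+jC2 ⟩
    2 * (2 ^ (j + c) * qbin (suc j + s) s)
      ≡⟨ cong (λ p → 2 * (p * qbin (suc j + s) s)) (^-distribˡ-+-* 2 j c) ⟩
    2 * (2 ^ j * 2 ^ c * qbin (suc j + s) s)
      ≡⟨ solve 3 (λ w p q → con 2 :* (w :* p :* q) := con 2 :* p :* (w :* q)) refl (2 ^ j) (2 ^ c) _ ⟩
    2 * 2 ^ c * (2 ^ j * qbin (suc j + s) s)
      <⟨ *-monoʳ-< (2 * 2 ^ c) (2^j*qbin-suc< j s j+s<e) ⟩
    2 * 2 ^ c * (2 ^ e * qbin (j + s) s)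
      ≡⟨ solve 3 (λ p w q → con 2 :* p :* (w :* q) := con 2 :* w :* (p :* q)) refl (2 ^ c) (2 ^ e) _ ⟩
    2 ^ suc e * (2 ^ c * qbin (j + s) s) ∎
    where
    open ≤-Reasoning
    c = j C 2
    [1+j]C2≡j+jC2 : suc j C 2 ≡ j + c
    [1+j]C2≡j+jC2 = trans (sym (nCk+nC[k+1]≡[n+1]C[k+1] j 1)) (cong (_+ c) (nC1≡n j))
    instance
      2*2^c-nonZero : NonZero (2 * 2 ^ c)
      2*2^c-nonZero = >-nonZero (m^n>0 2 (suc c))

module SumTo where

  open import Data.Nat using (ℕ; zero; suc)
  open import Data.Integer hiding (suc)
  open import Data.Integer.Properties
  open import Data.Integer.Solver using (module +-*-Solver)
  open import Function using (_∘_)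
  open import Relation.Binary.PropositionalEquality

  sumTo-cong : ∀ n {f g : ℕ → ℤ} → (∀ h → f h ≡ g h) → sumTo n f ≡ sumTo n g
  sumTo-cong zero    f≗g = f≗g 0
  sumTo-cong (suc n) f≗g = cong₂ _+_ (sumTo-cong n f≗g) (f≗g (suc n))

  sumTo-+ : ∀ n (f g : ℕ → ℤ) → sumTo n (λ h → f h + g h) ≡ sumTo n f + sumTo n g
  sumTo-+ zero    f g = refl
  sumTo-+ (suc n) f g =
    trans (cong (_+ (f (suc n) + g (suc n))) (sumTo-+ n f g))
          (interchange (sumTo n f) (sumTo n g) (f (suc n)) (g (suc n)))
    where
    open +-*-Solver
    interchange : ∀ a b c d → a + b + (c + d) ≡ a + c + (b + d)
    interchange = solve 4 (λ a b c d → a :+ b :+ (c :+ d) := a :+ c :+ (b :+ d)) refl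

  sumTo-*ˡ : ∀ n c (f : ℕ → ℤ) → sumTo n (λ h → c * f h) ≡ c * sumTo n f
  sumTo-*ˡ zero    c f = refl
  sumTo-*ˡ (suc n) c f =
    trans (cong (_+ c * f (suc n)) (sumTo-*ˡ n c f)) (sym (*-distribˡ-+ c _ _))

  sumTo-suc : ∀ n (f : ℕ → ℤ) → sumTo (suc n) f ≡ f 0 + sumTo n (f ∘ suc)
  sumTo-suc zero    f = refl
  sumTo-suc (suc n) f =
    trans (cong (_+ f (suc (suc n))) (sumTo-suc n f)) (+-assoc (f 0) _ _)

  sumTo-head : ∀ n (f : ℕ → ℤ) → (∀ h → f (suc h) ≡ 0ℤ) → sumTo n f ≡ f 0
  sumTo-head zero    f tail≡0 = refl
  sumTo-head (suc n) f tail≡0 =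
    trans (cong₂ _+_ (sumTo-head n f tail≡0) (tail≡0 n)) (+-identityʳ (f 0))

module Recurrence where

  open QBinomial
  open Summands
  open SumTo
  open import Data.Nat as ℕ using (ℕ; zero; suc; _∸_; _^_; _≤_; z≤n; s≤s)
  import Data.Nat.Properties as ℕ
  open import Data.Nat.Combinatorics using (_C_)
  open import Data.Integer using (ℤ; +_; _+_; _*_; _-_; 0ℤ)
  open import Data.Integer.Properties
  open import Data.Integer.Solver using (module +-*-Solver)
  open import Function using (_∘_)
  open import Relation.Binary.PropositionalEquality
  open +-*-Solver

  signedSummand : (d e j i h : ℕ) → ℤ
  signedSummand d e j i h = sign (j ∸ h) * + summand d e j i h

  [+m]-[+n]≡+[m∸n] : ∀ {m n} → n ≤ m → + m - + n ≡ + (m ∸ n)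
  [+m]-[+n]≡+[m∸n] {m} {n} n≤m = trans ([+m]-[+n]≡m⊖n m n) (⊖-≥ n≤m)

  i*+a*+b*+c≡i*+[a*b*c] : ∀ i a b c → i * + a * + b * + c ≡ i * + (a ℕ.* b ℕ.* c)
  i*+a*+b*+c≡i*+[a*b*c] i a b c = begin
    i * + a * + b * + c       ≡⟨ solve 4 (λ i a b c → i :* a :* b :* c := i :* (a :* b :* c)) refl i (+ a) (+ b) (+ c) ⟩
    i * (+ a * + b * + c)     ≡⟨ cong (λ x → i * (x * + c)) (sym (pos-* a b)) ⟩
    i * (+ (a ℕ.* b) * + c)   ≡⟨ cong (i *_) (sym (pos-* (a ℕ.* b) c)) ⟩
    i * + (a ℕ.* b ℕ.* c)     ∎
    where open ≡-Reasoning

  B-as-sum : ∀ {d j} e i → j ≤ d → B d e j i ≡ sumTo j (signedSummand d e j i)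
  B-as-sum {d} {j} e i j≤d = sumTo-cong j λ h →
    trans (cong₂ (λ a b → sign (j ∸ h) * + 2 ^ (e ℕ.* h ℕ.+ (j ∸ h) C 2) * a * b)
                 (trans (cong (gauss (d ∸ h)) ([+m]-[+n]≡+[m∸n] j≤d)) (gauss≡qbin (d ∸ h) (d ∸ j)))
                 (gauss≡qbin (d ∸ i) h))
          (i*+a*+b*+c≡i*+[a*b*c] (sign (j ∸ h)) _ _ _)

  B-at-j≡0 : ∀ d e i → B d e 0 i ≡ + 1
  B-at-j≡0 d e i = begin
    B d e 0 i                                             ≡⟨ B-as-sum e i z≤n ⟩
    + 1 * + summand d e 0 i 0                             ≡⟨ *-identityˡ _ ⟩
    + (2 ^ (e ℕ.* 0 ℕ.+ 0) ℕ.* qbin d d ℕ.* qbin (d ∸ i) 0)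
      ≡⟨ cong₂ (λ a b → + (2 ^ (a ℕ.+ 0) ℕ.* b ℕ.* qbin (d ∸ i) 0)) (ℕ.*-zeroʳ e) (qbin-diag d) ⟩
    + (1 ℕ.* qbin (d ∸ i) 0)                              ≡⟨ cong +_ (ℕ.*-identityˡ _) ⟩
    + qbin (d ∸ i) 0                                      ≡⟨ cong +_ (qbin-zeroʳ (d ∸ i)) ⟩
    + 1                                                   ∎
    where open ≡-Reasoning

  B-at-top : ∀ {d j} e → j ≤ d → B d e j d ≡ sign j * + (2 ^ (j C 2) ℕ.* qbin d (d ∸ j))
  B-at-top {d} {j} e j≤d = begin
    B d e j d
      ≡⟨ B-as-sum e d j≤d ⟩
    sumTo j (signedSummand d e j d)
      ≡⟨ sumTo-head j _ tail≡0 ⟩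
    sign j * + (2 ^ (e ℕ.* 0 ℕ.+ j C 2) ℕ.* qbin d (d ∸ j) ℕ.* qbin (d ∸ d) 0)
      ≡⟨ cong₂ (λ a b → sign j * + (2 ^ (a ℕ.+ j C 2) ℕ.* qbin d (d ∸ j) ℕ.* b))
               (ℕ.*-zeroʳ e) (qbin-zeroʳ (d ∸ d)) ⟩
    sign j * + (2 ^ (j C 2) ℕ.* qbin d (d ∸ j) ℕ.* 1)
      ≡⟨ cong (λ x → sign j * + x) (ℕ.*-identityʳ _) ⟩
    sign j * + (2 ^ (j C 2) ℕ.* qbin d (d ∸ j)) ∎
    where
    open ≡-Reasoning
    tail≡0 : ∀ h → signedSummand d e j d (suc h) ≡ 0ℤ
    tail≡0 h rewrite ℕ.n∸n≡0 d
                   | ℕ.*-zeroʳ (2 ^ (e ℕ.* suc h ℕ.+ (j ∸ suc h) C 2) ℕ.* qbin (d ∸ suc h) (d ∸ j))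
                   = *-zeroʳ (sign (j ∸ suc h))

  signedSummand-head : ∀ d e j i i′ → signedSummand d e j i 0 ≡ signedSummand d e j i′ 0
  signedSummand-head d e j i i′ =
    cong (λ x → sign j * + (2 ^ (e ℕ.* 0 ℕ.+ j C 2) ℕ.* qbin d (d ∸ j) ℕ.* x))
         (trans (qbin-zeroʳ (d ∸ i)) (sym (qbin-zeroʳ (d ∸ i′))))

  signedSummand-pascal : ∀ {d i} e j h → i ≤ d →
    signedSummand (suc d) (suc e) (suc j) i (suc h)
      ≡ + 2 ^ (suc e ℕ.+ (d ∸ i)) * signedSummand d e j i h
        + signedSummand (suc d) (suc e) (suc j) (suc i) (suc h)
  signedSummand-pascal {d} {i} e j h i≤d = begin
    sign (j ∸ h) * + summand (suc d) (suc e) (suc j) i (suc h)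
      ≡⟨ cong (λ x → sign (j ∸ h) * + x) (summand-pascal e j h i≤d) ⟩
    sign (j ∸ h) * + (w ℕ.* s ℕ.+ s′)
      ≡⟨ cong (sign (j ∸ h) *_) (trans (pos-+ (w ℕ.* s) s′) (cong (_+ + s′) (pos-* w s))) ⟩
    sign (j ∸ h) * (+ w * + s + + s′)
      ≡⟨ solve 4 (λ σ w s s′ → σ :* (w :* s :+ s′) := w :* (σ :* s) :+ σ :* s′) refl (sign (j ∸ h)) (+ w) (+ s) (+ s′) ⟩
    + w * (sign (j ∸ h) * + s) + sign (j ∸ h) * + s′ ∎
    where
    open ≡-Reasoning
    w = 2 ^ (suc e ℕ.+ (d ∸ i))
    s = summand d e j i h
    s′ = summand (suc d) (suc e) (suc j) (suc i) (suc h)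

  B-recurrence : ∀ {d j i} e → j ≤ d → i ≤ d →
    B (suc d) (suc e) (suc j) i
      ≡ + 2 ^ (suc e ℕ.+ (d ∸ i)) * B d e j i + B (suc d) (suc e) (suc j) (suc i)
  B-recurrence {d} {j} {i} e j≤d i≤d = begin
    B (suc d) (suc e) (suc j) i
      ≡⟨ B-as-sum (suc e) i (s≤s j≤d) ⟩
    sumTo (suc j) (F i)
      ≡⟨ sumTo-suc j (F i) ⟩
    F i 0 + sumTo j (F i ∘ suc)
      ≡⟨ cong₂ _+_ (signedSummand-head (suc d) (suc e) (suc j) i (suc i))
                   (sumTo-cong j λ h → signedSummand-pascal e j h i≤d) ⟩
    F (suc i) 0 + sumTo j (λ h → w * signedSummand d e j i h + F (suc i) (suc h))
      ≡⟨ cong (_+_ (F (suc i) 0)) (trans (sumTo-+ j _ _) (cong (_+ sumTo j (F (suc i) ∘ suc)) (sumTo-*ˡ j w _))) ⟩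
    F (suc i) 0 + (w * sumTo j (signedSummand d e j i) + sumTo j (F (suc i) ∘ suc))
      ≡⟨ solve 3 (λ a b c → a :+ (b :+ c) := b :+ (a :+ c)) refl (F (suc i) 0) (w * sumTo j (signedSummand d e j i)) _ ⟩
    w * sumTo j (signedSummand d e j i) + (F (suc i) 0 + sumTo j (F (suc i) ∘ suc))
      ≡⟨ cong₂ (λ b b′ → w * b + b′)
               (sym (B-as-sum e i j≤d))
               (trans (sym (sumTo-suc j (F (suc i)))) (sym (B-as-sum (suc e) (suc i) (s≤s j≤d)))) ⟩
    w * B d e j i + B (suc d) (suc e) (suc j) (suc i) ∎
    where
    open ≡-Reasoning
    F : ℕ → ℕ → ℤ
    F = signedSummand (suc d) (suc e) (suc j)
    w : ℤ
    w = + 2 ^ (suc e ℕ.+ (d ∸ i))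

module Signs where

  open import Data.Nat as ℕ using (ℕ; zero; suc; _∸_; _<_; _≤_)
  import Data.Nat.Properties as ℕ
  open import Data.Integer using (ℤ; +_; -_; _+_; _*_; ∣_∣)
  open import Data.Integer.Properties using (abs-*; ∣-i∣≡∣i∣; pos-+; pos-*)
  open import Data.Integer.Solver using (module +-*-Solver)
  open import Data.Product using (_×_; _,_)
  open import Relation.Binary.PropositionalEquality
  open +-*-Solver

  record Signed (k : ℕ) (x : ℤ) : Set where
    constructor mkSigned
    field
      form    : x ≡ sign k * + ∣ x ∣
      nonzero : 0 < ∣ x ∣

  ∣sign∣≡1 : ∀ k → ∣ sign k ∣ ≡ 1
  ∣sign∣≡1 zero    = refl
  ∣sign∣≡1 (suc k) = trans (∣-i∣≡∣i∣ (sign k)) (∣sign∣≡1 k)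

  ∣sign*+n∣≡n : ∀ k n → ∣ sign k * + n ∣ ≡ n
  ∣sign*+n∣≡n k n = trans (abs-* (sign k) (+ n)) (trans (cong (ℕ._* n) (∣sign∣≡1 k)) (ℕ.*-identityˡ n))

  sign*-Signed : ∀ k {n} → 0 < n → Signed k (sign k * + n)
  sign*-Signed k {n} n>0 =
    mkSigned (cong (λ m → sign k * + m) (sym (∣sign*+n∣≡n k n))) (subst (0 <_) (sym (∣sign*+n∣≡n k n)) n>0)

  Signed-*ˡ : ∀ {k x n} → 0 < n → Signed k x → Signed k (+ n * x) × ∣ + n * x ∣ ≡ n ℕ.* ∣ x ∣
  Signed-*ˡ {k} {x} {n} n>0 (mkSigned x≡ x>0) =
    subst (Signed k) (sym eq) (sign*-Signed k (ℕ.*-mono-≤ n>0 x>0)) , abs-* (+ n) x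
    where
    eq : + n * x ≡ sign k * + (n ℕ.* ∣ x ∣)
    eq = begin
      + n * x                   ≡⟨ cong (+ n *_) x≡ ⟩
      + n * (sign k * + ∣ x ∣)  ≡⟨ solve 3 (λ n σ a → n :* (σ :* a) := σ :* (n :* a)) refl (+ n) (sign k) (+ ∣ x ∣) ⟩
      sign k * (+ n * + ∣ x ∣)  ≡⟨ cong (sign k *_) (sym (pos-* n ∣ x ∣)) ⟩
      sign k * + (n ℕ.* ∣ x ∣)  ∎
      where open ≡-Reasoning

  Signed-+-same : ∀ {k x y} → Signed k x → Signed k y → Signed k (x + y) × ∣ y ∣ < ∣ x + y ∣
  Signed-+-same {k} {x} {y} (mkSigned x≡ x>0) (mkSigned y≡ _) =
    subst (λ z → Signed k z × ∣ y ∣ < ∣ z ∣) (sym eq)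
      (sign*-Signed k (ℕ.<-≤-trans x>0 (ℕ.m≤m+n ∣ x ∣ ∣ y ∣))
      , subst (∣ y ∣ <_) (sym (∣sign*+n∣≡n k _)) (ℕ.m<n+m ∣ y ∣ x>0))
    where
    eq : x + y ≡ sign k * + (∣ x ∣ ℕ.+ ∣ y ∣)
    eq = begin
      x + y                                ≡⟨ cong₂ _+_ x≡ y≡ ⟩
      sign k * + ∣ x ∣ + sign k * + ∣ y ∣  ≡⟨ solve 3 (λ σ a b → σ :* a :+ σ :* b := σ :* (a :+ b)) refl (sign k) (+ ∣ x ∣) (+ ∣ y ∣) ⟩
      sign k * (+ ∣ x ∣ + + ∣ y ∣)         ≡⟨ cong (sign k *_) (sym (pos-+ ∣ x ∣ ∣ y ∣)) ⟩
      sign k * + (∣ x ∣ ℕ.+ ∣ y ∣)         ∎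
      where open ≡-Reasoning

  Signed-+-opposite : ∀ {k x y} → Signed k x → Signed (suc k) y → 2 ℕ.* ∣ y ∣ < ∣ x ∣ →
    Signed k (x + y) × ∣ y ∣ < ∣ x + y ∣ × ∣ x + y ∣ ≤ ∣ x ∣
  Signed-+-opposite {k} {x} {y} (mkSigned x≡ _) (mkSigned y≡ _) 2y<x =
    subst (λ z → Signed k z × ∣ y ∣ < ∣ z ∣ × ∣ z ∣ ≤ ∣ x ∣) (sym eq)
      (sign*-Signed k (ℕ.<-≤-trans ℕ.z<s y<x∸y)
      , subst (∣ y ∣ <_) (sym (∣sign*+n∣≡n k _)) y<x∸y
      , subst (_≤ ∣ x ∣) (sym (∣sign*+n∣≡n k _)) (ℕ.m∸n≤m ∣ x ∣ ∣ y ∣))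
    where
    y+y<x : ∣ y ∣ ℕ.+ ∣ y ∣ < ∣ x ∣
    y+y<x = subst (λ m → ∣ y ∣ ℕ.+ m < ∣ x ∣) (ℕ.+-identityʳ ∣ y ∣) 2y<x
    y<x∸y : ∣ y ∣ < ∣ x ∣ ∸ ∣ y ∣
    y<x∸y = ℕ.m+n≤o⇒m≤o∸n (suc ∣ y ∣) y+y<x
    y≤x : ∣ y ∣ ≤ ∣ x ∣
    y≤x = ℕ.≤-trans (ℕ.m≤m+n ∣ y ∣ ∣ y ∣) (ℕ.<⇒≤ y+y<x)
    eq : x + y ≡ sign k * + (∣ x ∣ ∸ ∣ y ∣)
    eq = begin
      x + y
        ≡⟨ cong₂ _+_ x≡ y≡ ⟩
      sign k * + ∣ x ∣ + (- sign k) * + ∣ y ∣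
        ≡⟨ cong (λ m → sign k * + m + (- sign k) * + ∣ y ∣) (sym (ℕ.m∸n+n≡m y≤x)) ⟩
      sign k * + (∣ x ∣ ∸ ∣ y ∣ ℕ.+ ∣ y ∣) + (- sign k) * + ∣ y ∣
        ≡⟨ cong (λ z → sign k * z + (- sign k) * + ∣ y ∣) (pos-+ (∣ x ∣ ∸ ∣ y ∣) ∣ y ∣) ⟩
      sign k * (+ (∣ x ∣ ∸ ∣ y ∣) + + ∣ y ∣) + (- sign k) * + ∣ y ∣
        ≡⟨ solve 3 (λ σ a b → σ :* (a :+ b) :+ (:- σ) :* b := σ :* a) refl (sign k) (+ (∣ x ∣ ∸ ∣ y ∣)) (+ ∣ y ∣) ⟩
      sign k * + (∣ x ∣ ∸ ∣ y ∣) ∎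
      where open ≡-Reasoning

module Levels where

  open QBinomial
  open Summands
  open Recurrence
  open Signs
  open import Data.Nat
  open import Data.Nat.Properties
  open import Data.Nat.Combinatorics using (_C_)
  open import Data.Integer as ℤ using (ℤ; +_; ∣_∣)
  open import Data.Product using (_×_; _,_; proj₁; proj₂)
  open import Data.Sum using (inj₁; inj₂)
  open import Data.Empty using (⊥-elim)
  open import Relation.Binary.PropositionalEquality

  ∣B-at-top∣ : ∀ {d j} e → j ≤ d → ∣ B d e j d ∣ ≡ 2 ^ (j C 2) * qbin d (d ∸ j)
  ∣B-at-top∣ {d} {j} e j≤d = trans (cong ∣_∣ (B-at-top e j≤d)) (∣sign*+n∣≡n j _)

  B-at-top-< : ∀ {d j} e → j ≤ d → suc d ≤ e →
    2 * ∣ B (suc d) (suc e) (suc j) (suc d) ∣ < 2 ^ suc e * ∣ B d e j d ∣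
  B-at-top-< {d} {j} e j≤d d<e = begin-strict
    2 * ∣ B (suc d) (suc e) (suc j) (suc d) ∣    ≡⟨ cong (2 *_) (∣B-at-top∣ (suc e) (s≤s j≤d)) ⟩
    2 * (2 ^ (suc j C 2) * qbin (suc d) s)       ≡⟨ cong (λ n → 2 * (2 ^ (suc j C 2) * qbin (suc n) s)) (sym j+s≡d) ⟩
    2 * (2 ^ (suc j C 2) * qbin (suc j + s) s)   <⟨ top-corner< j s (subst (λ n → suc n ≤ e) (sym j+s≡d) d<e) ⟩
    2 ^ suc e * (2 ^ (j C 2) * qbin (j + s) s)   ≡⟨ cong (λ n → 2 ^ suc e * (2 ^ (j C 2) * qbin n s)) j+s≡d ⟩
    2 ^ suc e * (2 ^ (j C 2) * qbin d s)         ≡⟨ cong (2 ^ suc e *_) (sym (∣B-at-top∣ e j≤d)) ⟩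
    2 ^ suc e * ∣ B d e j d ∣                    ∎
    where
    open ≤-Reasoning
    s = d ∸ j
    j+s≡d : j + s ≡ d
    j+s≡d = m+[n∸m]≡n j≤d

  -- Column j at (d, e) determines column j+1 at (d+1, e+1) by descending induction on i.
  module SuccessorColumn {d e j} (d<e : suc d ≤ e) (j≤d : j ≤ d)
    (signed : ∀ {i} → i ≤ d → Signed (i ∸ (d ∸ j)) (B d e j i))
    (decreasing : ∀ {i} → d ∸ j ≤ i → i < d → ∣ B d e j (suc i) ∣ < ∣ B d e j i ∣)
    where

    c : ℕ
    c = d ∸ j

    B′ : ℕ → ℤ
    B′ = B (suc d) (suc e) (suc j)

    weight : ℕ → ℕ
    weight i = 2 ^ (suc e + (d ∸ i))

    T : ℕ → ℤ
    T i = + weight i ℤ.* B d e j i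

    T-signed : ∀ {i} → i ≤ d → Signed (i ∸ c) (T i) × ∣ T i ∣ ≡ weight i * ∣ B d e j i ∣
    T-signed {i} i≤d = Signed-*ˡ (m^n>0 2 (suc e + (d ∸ i))) (signed i≤d)

    Invariant : ℕ → Set
    Invariant i = Signed (i ∸ c) (B′ i) × (c ≤ i → i ≤ d → ∣ B′ i ∣ ≤ ∣ T i ∣)

    invariant-top : Invariant (suc d)
    invariant-top = subst (Signed (suc d ∸ c)) (sym (B-at-top (suc e) (s≤s j≤d)))
                      (subst (λ k → Signed k (sign (suc j) ℤ.* + top)) (sym sd∸c≡sj) (sign*-Signed (suc j) top>0))
                  , λ _ sd≤d → ⊥-elim (<-irrefl refl sd≤d)
      where
      sd∸c≡sj : suc d ∸ c ≡ suc j
      sd∸c≡sj = trans (+-∸-assoc 1 (m∸n≤m d j)) (cong suc (m∸[m∸n]≡n j≤d))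
      top = 2 ^ (suc j C 2) * qbin (suc d) c
      top>0 : 0 < top
      top>0 = *-mono-≤ (m^n>0 2 (suc j C 2)) (qbin-pos (m≤n⇒m≤1+n (m∸n≤m d j)))

    -- |B′(i+1)| ≤ |T(i+1)| and 2|T(i+1)| < |T(i)| since the weight halves and |B_j| decreases.
    twice-next<T : ∀ {i} → c ≤ i → i ≤ d → Invariant (suc i) → 2 * ∣ B′ (suc i) ∣ < ∣ T i ∣
    twice-next<T {i} c≤i i≤d (_ , bounded) with m≤n⇒m<n∨m≡n i≤d
    ... | inj₁ i<d = begin-strict
      2 * ∣ B′ (suc i) ∣                         ≤⟨ *-monoʳ-≤ 2 (bounded (m≤n⇒m≤1+n c≤i) i<d) ⟩
      2 * ∣ T (suc i) ∣                          ≡⟨ cong (2 *_) (proj₂ (T-signed i<d)) ⟩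
      2 * (weight (suc i) * ∣ B d e j (suc i) ∣) ≡⟨ sym (*-assoc 2 (weight (suc i)) _) ⟩
      2 * weight (suc i) * ∣ B d e j (suc i) ∣   <⟨ *-monoʳ-< (2 * weight (suc i)) (decreasing c≤i i<d) ⟩
      2 * weight (suc i) * ∣ B d e j i ∣         ≡⟨ cong (_* ∣ B d e j i ∣) weight-halves ⟩
      weight i * ∣ B d e j i ∣                   ≡⟨ sym (proj₂ (T-signed i≤d)) ⟩
      ∣ T i ∣                                    ∎
      where
      open ≤-Reasoning
      instance
        2*weight-nonZero : NonZero (2 * weight (suc i))
        2*weight-nonZero = >-nonZero (m^n>0 2 (suc (suc e + (d ∸ suc i))))
      weight-halves : 2 * weight (suc i) ≡ weight i
      weight-halves = cong (2 ^_) (sym (trans (cong (_+_ (suc e)) (+-∸-assoc 1 i<d)) (+-suc (suc e) (d ∸ suc i))))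
    ... | inj₂ refl = begin-strict
      2 * ∣ B′ (suc d) ∣               <⟨ B-at-top-< e j≤d d<e ⟩
      2 ^ suc e * ∣ B d e j d ∣        ≡⟨ cong (λ n → 2 ^ n * ∣ B d e j d ∣) (sym e+d∸d≡e) ⟩
      weight d * ∣ B d e j d ∣         ≡⟨ sym (proj₂ (T-signed i≤d)) ⟩
      ∣ T d ∣                          ∎
      where
      open ≤-Reasoning
      e+d∸d≡e : suc e + (d ∸ d) ≡ suc e
      e+d∸d≡e = trans (cong (_+_ (suc e)) (n∸n≡0 d)) (+-identityʳ (suc e))

    unfold-B′ : ∀ {i} (P : ℤ → Set) → i ≤ d → P (T i ℤ.+ B′ (suc i)) → P (B′ i)
    unfold-B′ P i≤d = subst P (sym (B-recurrence e j≤d i≤d))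

    step-constant : ∀ {i} → i ≤ d → i < c → Invariant (suc i) → Invariant i × ∣ B′ (suc i) ∣ < ∣ B′ i ∣
    step-constant {i} i≤d i<c (next-signed , _) =
      (unfold-B′ (Signed (i ∸ c)) i≤d (proj₁ same) , λ c≤i _ → ⊥-elim (<⇒≱ i<c c≤i))
      , unfold-B′ (λ x → ∣ B′ (suc i) ∣ < ∣ x ∣) i≤d (proj₂ same)
      where
      same = Signed-+-same (proj₁ (T-signed i≤d))
               (subst (λ k → Signed k (B′ (suc i)))
                      (trans (m≤n⇒m∸n≡0 i<c) (sym (m≤n⇒m∸n≡0 (<⇒≤ i<c)))) next-signed)

    step-alternating : ∀ {i} → i ≤ d → c ≤ i → Invariant (suc i) → Invariant i × ∣ B′ (suc i) ∣ < ∣ B′ i ∣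
    step-alternating {i} i≤d c≤i next@(next-signed , _) =
      (unfold-B′ (Signed (i ∸ c)) i≤d signed′ , λ _ _ → unfold-B′ (λ x → ∣ x ∣ ≤ ∣ T i ∣) i≤d bounded′)
      , unfold-B′ (λ x → ∣ B′ (suc i) ∣ < ∣ x ∣) i≤d growing′
      where
      opposite = Signed-+-opposite (proj₁ (T-signed i≤d))
                   (subst (λ k → Signed k (B′ (suc i))) (+-∸-assoc 1 c≤i) next-signed)
                   (twice-next<T c≤i i≤d next)
      signed′ = proj₁ opposite
      growing′ = proj₁ (proj₂ opposite)
      bounded′ = proj₂ (proj₂ opposite)

    step : ∀ {i} → i ≤ d → Invariant (suc i) → Invariant i × ∣ B′ (suc i) ∣ < ∣ B′ i ∣
    step {i} i≤d with ≤-<-connex c i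
    ... | inj₁ c≤i = step-alternating i≤d c≤i
    ... | inj₂ i<c = step-constant i≤d i<c

    descend : ∀ k → k ≤ suc d → Invariant (suc d ∸ k)
    descend zero    _         = invariant-top
    descend (suc k) (s≤s k≤d) =
      proj₁ (step (m∸n≤m d k) (subst Invariant (+-∸-assoc 1 k≤d) (descend k (m≤n⇒m≤1+n k≤d))))

    invariant : ∀ {i} → i ≤ suc d → Invariant i
    invariant {i} i≤sd = subst Invariant (m∸[m∸n]≡n i≤sd) (descend (suc d ∸ i) (m∸n≤m (suc d) i))

    column-signed : ∀ {i} → i ≤ suc d → Signed (i ∸ c) (B′ i)
    column-signed i≤sd = proj₁ (invariant i≤sd)

    column-decreasing : ∀ {i} → i < suc d → ∣ B′ (suc i) ∣ < ∣ B′ i ∣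
    column-decreasing (s≤s i≤d) = proj₂ (step i≤d (invariant (s≤s i≤d)))

  B-at-j≡0-signed : ∀ {d i} e → i ≤ d → Signed (i ∸ d) (B d e 0 i)
  B-at-j≡0-signed {d} {i} e i≤d =
    subst₂ Signed (sym (m≤n⇒m∸n≡0 i≤d)) (sym (B-at-j≡0 d e i)) (mkSigned refl z<s)

  d∸j≤i<d⇒1≤j : ∀ {d j i} → d ∸ j ≤ i → i < d → 1 ≤ j
  d∸j≤i<d⇒1≤j {j = zero}  d≤i i<d = ⊥-elim (<⇒≱ i<d d≤i)
  d∸j≤i<d⇒1≤j {j = suc j} _   _   = s≤s z≤n

  SignPattern : ℕ → ℕ → Set
  SignPattern d e = ∀ {j i} → j ≤ d → i ≤ d → Signed (i ∸ (d ∸ j)) (B d e j i)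

  Decreasing : ℕ → ℕ → Set
  Decreasing d e = ∀ {j i} → 1 ≤ j → j ≤ d → i < d → ∣ B d e j (suc i) ∣ < ∣ B d e j i ∣

  signPattern×decreasing : ∀ d e → suc d ≤ e → SignPattern d e × Decreasing d e
  signPattern×decreasing zero    e       _         = (λ { z≤n i≤0 → B-at-j≡0-signed e i≤0 }) , λ _ _ ()
  signPattern×decreasing (suc d) (suc e) (s≤s d<e) = signed , decreasing
    where
    IH = signPattern×decreasing d e d<e
    module Column {j} (j≤d : j ≤ d) =
      SuccessorColumn d<e j≤d (proj₁ IH j≤d) (λ c≤i i<d → proj₂ IH (d∸j≤i<d⇒1≤j c≤i i<d) j≤d i<d)
    signed : SignPattern (suc d) (suc e)
    signed z≤n       i≤sd = B-at-j≡0-signed (suc e) i≤sd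
    signed (s≤s j≤d) i≤sd = Column.column-signed j≤d i≤sd
    decreasing : Decreasing (suc d) (suc e)
    decreasing {suc j} _ (s≤s j≤d) i<sd = Column.column-decreasing j≤d i<sd


open import Data.Nat using (ℕ; _≤_; _<_; _+_)
open import Data.Integer using (∣_∣)
open import Data.Nat.Properties using (+-comm)
open import Data.Product using (proj₂)
open import Relation.Binary.PropositionalEquality using (subst)

theorem4p6 : (d e : ℕ) → 1 ≤ d → d + 1 ≤ e →
    (i j : ℕ) → i < d → 1 ≤ j → j ≤ d →
    ∣ B d e j (i + 1) ∣ < ∣ B d e j i ∣
theorem4p6 d e _ d+1≤e i j i<d 1≤j j≤d =
  subst (λ k → ∣ B d e j k ∣ < ∣ B d e j i ∣) (+-comm 1 i)
    (proj₂ (Levels.signPattern×decreasing d e (subst (_≤ e) (+-comm d 1) d+1≤e)) 1≤j j≤d i<d)
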